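{- Let $t\ge2$ and let $n_1,\dots,n_t\ge3$. Let $G=Edge\text{ - }Amal\{C_{n_i}\}_{i=1}^t$ be the edge amalgamation of the cycles $C_{n_1},\dots,C_{n_t}$, and let $D$ be an orientation of $G$ in which each of the $t$ cycles is a directed cycle. Then the directed metric dimension of $D$ is $\dim(D)=t-1$.
   Context: The edge amalgamation $Edge\text{ - }Amal\{C_{n_i}\}_{i=1}^t$ is the graph obtained from disjoint cycles $C_{n_1},\dots,C_{n_t}$ by identifying one edge of each cycle into a single common edge (the terminal edge). For a strongly connected oriented graph $D$, $d(u,v)$ is the minimum length of a directed path from $u$ to $v$; for a nonempty ordered set $B=\{b_1,\dots,b_k\}\subseteq V(D)$, $r(v|B)=(d(v,b_1),\dots,d(v,b_k))$; $B$ is resolving if distinct vertices have distinct representations; $\dim(D)$ is the minimum cardinality of a resolving set. -}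

module Defs where

open import Data.Nat using (ℕ; zero; suc; _≤_; _<_; _∸_)
open import Data.Fin using (Fin; toℕ)
open import Data.Product using (Σ; ∃; _×_; _,_)
open import Data.Sum using (_⊎_)
open import Data.Empty using (⊥)
open import Data.List using (List; []; length)
open import Data.List.Relation.Unary.All using (All)
open import Data.List.Relation.Unary.Unique.Propositional using (Unique)
open import Relation.Binary.PropositionalEquality using (_≡_; _≢_)
open import Relation.Nullary using (¬_)

-- Vertices of Edge-Amal{C_{n_i}}_{i=1}^t.
-- ta, tb : the two end vertices of the common (terminal) edge;
-- inr i j : the j-th (0-based) of the n_i - 2 remaining vertices of cycle i.
data V (t : ℕ) (n : Fin t → ℕ) : Set where
  ta tb : V t n
  inr   : (i : Fin t) → Fin (n i ∸ 2) → V t n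

-- Cyclic successor relation of the i-th cycle, traversed as
--   ta , tb , inr i 0 , inr i 1 , … , inr i (n_i - 3) , ta .
-- Its underlying unordered pairs are exactly the n_i edges of C_{n_i}.
data Step {t : ℕ} {n : Fin t → ℕ} (i : Fin t) : V t n → V t n → Set where
  st-ab : Step i ta tb
  st-b  : (j : Fin (n i ∸ 2)) → toℕ j ≡ 0 → Step i tb (inr i j)
  st-in : (j k : Fin (n i ∸ 2)) → suc (toℕ j) ≡ toℕ k → Step i (inr i j) (inr i k)
  st-a  : (j : Fin (n i ∸ 2)) → suc (toℕ j) ≡ n i ∸ 2 → Step i (inr i j) ta

Adj : {t : ℕ} {n : Fin t → ℕ} → V t n → V t n → Set
Adj u v = ∃ λ i → Step i u v ⊎ Step i v u

IsOrientation : {t : ℕ} {n : Fin t → ℕ} → (V t n → V t n → Set) → Set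
IsOrientation {t} {n} Arc =
  (∀ u v → Arc u v → Adj u v) ×
  (∀ (i : Fin t) u v → Step i u v → (Arc u v ⊎ Arc v u) × ¬ (Arc u v × Arc v u))

EachCycleDirected : {t : ℕ} {n : Fin t → ℕ} → (V t n → V t n → Set) → Set
EachCycleDirected {t} {n} Arc =
  ∀ (i : Fin t) →
    (∀ u v → Step i u v → Arc u v) ⊎ (∀ u v → Step i u v → Arc v u)

data Walk {A : Set} (Arc : A → A → Set) : A → A → ℕ → Set where
  nil  : ∀ {u} → Walk Arc u u 0
  cons : ∀ {u w v k} → Arc u w → Walk Arc w v k → Walk Arc u v (suc k)

IsDist : {A : Set} → (A → A → Set) → A → A → ℕ → Set
IsDist Arc u v k = Walk Arc u v k × (∀ k' → k' < k → ¬ Walk Arc u v k')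

SameRep : {A : Set} → (A → A → Set) → List A → A → A → Set
SameRep Arc B x y = All (λ b → ∃ λ k → IsDist Arc x b k × IsDist Arc y b k) B

IsResolvingSet : {A : Set} → (A → A → Set) → List A → Set
IsResolvingSet Arc B =
  B ≢ [] × Unique B × (∀ x y → SameRep Arc B x y → x ≡ y)

MetricDim : {A : Set} → (A → A → Set) → ℕ → Set
MetricDim Arc d =
  (∃ λ B → IsResolvingSet Arc B × length B ≡ d) ×
  (∀ B → IsResolvingSet Arc B → d ≤ length B)

module Submission where

-- The terminal edge ta–tb lies on every cycle and is oriented only once, so either every
-- cycle is directed along its successor relation (ta → tb → inner vertices → ta) or every
-- cycle against it, and the reversal ta ↔ tb, j ↦ nᵢ − 3 − j carries the second digraph
-- onto the first. There, let eᵢ be the last inner vertex of cycle i. Its only out-neighbour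
-- is ta, so d(eᵢ, b) = 1 + d(ta, b) for b ≠ eᵢ: two of the eᵢ missing from a resolving set B
-- would get the same representation, hence B contains all but at most one eᵢ and
-- |B| ≥ t − 1. Conversely {e₁, …, e_{t−1}} resolves: with mᵢ = nᵢ − 2, d(·, eᵢ) is < mᵢ on
-- the inner vertices of cycle i, mᵢ at tb, mᵢ + 1 at ta and > mᵢ + 1 on the other inner
-- vertices, and it is injective on the inner vertices of any one cycle.

open import Defs
open import Data.Nat using (ℕ; zero; suc; _+_; _≤_; _<_; _∸_; z≤n; s≤s; s≤s⁻¹; z<s)
open import Data.Nat.Properties
open import Data.Fin as Fin using (Fin; toℕ; fromℕ; fromℕ<; inject₁; opposite)
open import Data.Fin.Properties
  using (toℕ-injective; toℕ<n; toℕ-fromℕ<; opposite-prop; opposite-involutive;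
         inject₁-injective; injective⇒≤)
import Data.Fin.Properties as Fin
open import Data.Product using (∃; _×_; _,_; proj₁; proj₂; swap)
open import Data.Sum as Sum using (_⊎_; inj₁; inj₂; [_,_]′)
open import Data.Empty using (⊥; ⊥-elim)
open import Data.List as List using (List; []; _∷_; length; map; allFin)
open import Data.List.Properties using (length-map; length-tabulate)
import Data.List.Relation.Unary.All as All
open import Data.List.Relation.Unary.All.Properties using (map⁻)
import Data.List.Relation.Unary.Any as Any
open import Data.List.Relation.Unary.Any.Properties using (lookup-index)
import Data.List.Relation.Unary.Unique.Propositional.Properties as Unique
open import Data.List.Membership.Propositional using (_∉_)
open import Data.List.Membership.Propositional.Properties using (∈-map⁺; ∈-allFin)
open import Function using (_∘_; id)
open import Function.Construct.Composition using (_⇔-∘_)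
open import Function.Bundles using (_⇔_; mk⇔; Equivalence)
open import Relation.Binary.Definitions using (DecidableEquality)
open import Relation.Binary.PropositionalEquality
open import Relation.Nullary using (¬_; Dec; yes; no; contradiction)

m∸n≤1+m∸[1+n] : ∀ m n → m ∸ n ≤ suc (m ∸ suc n)
m∸n≤1+m∸[1+n] zero    zero    = z≤n
m∸n≤1+m∸[1+n] zero    (suc n) = z≤n
m∸n≤1+m∸[1+n] (suc m) zero    = ≤-refl
m∸n≤1+m∸[1+n] (suc m) (suc n) = m∸n≤1+m∸[1+n] m n

m+[n∸[1+m]]≡n∸1 : ∀ {m n} → m < n → m + (n ∸ suc m) ≡ n ∸ 1
m+[n∸[1+m]]≡n∸1 {n = suc n} (s≤s m≤n) = m+[n∸m]≡n m≤n

suc-toℕ-opposite : ∀ {m} (j : Fin m) → suc (toℕ (opposite j)) ≡ m ∸ toℕ j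
suc-toℕ-opposite j = trans (cong suc (opposite-prop j)) (sym (+-∸-assoc 1 (toℕ<n j)))

outside⇒≢ : ∀ {a x} → x < a ⊎ suc a < x → a ≢ x × suc a ≢ x
outside⇒≢ (inj₁ x<a)   =
  (λ a≡x → <-irrefl (sym a≡x) x<a) , (λ 1+a≡x → <-irrefl (sym 1+a≡x) (<-trans x<a (n<1+n _)))
outside⇒≢ (inj₂ 1+a<x) =
  (λ a≡x → <-irrefl a≡x (<-trans (n<1+n _) 1+a<x)) , (λ 1+a≡x → <-irrefl 1+a≡x 1+a<x)

inject₁⊎fromℕ : ∀ {r} (k : Fin (suc r)) → (∃ λ a → inject₁ a ≡ k) ⊎ k ≡ fromℕ r
inject₁⊎fromℕ {zero}  Fin.zero    = inj₂ refl
inject₁⊎fromℕ {suc r} Fin.zero    = inj₁ (Fin.zero , refl)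
inject₁⊎fromℕ {suc r} (Fin.suc k) with inject₁⊎fromℕ k
... | inj₁ (a , refl) = inj₁ (Fin.suc a , refl)
... | inj₂ refl       = inj₂ refl

-- Walks and distances in an arbitrary digraph

module Walks {A : Set} (R : A → A → Set) where

  _++ʷ_ : ∀ {u w v a b} → Walk R u w a → Walk R w v b → Walk R u v (a + b)
  nil      ++ʷ q = q
  cons e p ++ʷ q = cons e (p ++ʷ q)

  IsPotential : A → (A → ℕ) → Set
  IsPotential b g = g b ≡ 0 × (∀ u v → R u v → g u ≤ suc (g v))

  potential≤length : ∀ {b g} → IsPotential b g → ∀ {u k} → Walk R u b k → g u ≤ k
  potential≤length (gb≡0 , _)    nil = ≤-reflexive gb≡0
  potential≤length (gb≡0 , step) (cons {u} {w} e p) =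
    ≤-trans (step u w e) (s≤s (potential≤length (gb≡0 , step) p))

  isDist-potential : ∀ {b g} → IsPotential b g → ∀ {u} → Walk R u b (g u) → IsDist R u b (g u)
  isDist-potential pot w = w , λ k k<g w′ → <⇒≱ k<g (potential≤length pot w′)

  isDist-unique : ∀ {u b k k′} → IsDist R u b k → IsDist R u b k′ → k ≡ k′
  isDist-unique {k = k} {k′} (w , min) (w′ , min′) =
    ≤-antisym (≮⇒≥ λ k′<k → min k′ k′<k w′) (≮⇒≥ λ k<k′ → min′ k k<k′ w)

walk-map : ∀ {A B : Set} {R : A → A → Set} {S : B → B → Set} (f : A → B) →
           (∀ {u v} → R u v → S (f u) (f v)) → ∀ {u v k} → Walk R u v k → Walk S (f u) (f v) k
walk-map f arc nil        = nil
walk-map f arc (cons e p) = cons (arc e) (walk-map f arc p)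

-- Metric dimension is invariant under digraph isomorphism

record _≅_ {A B : Set} (R : A → A → Set) (S : B → B → Set) : Set where
  field
    to       : A → B
    from     : B → A
    from∘to  : ∀ x → from (to x) ≡ x
    to∘from  : ∀ y → to (from y) ≡ y
    to-arc   : ∀ {u v} → R u v → S (to u) (to v)
    from-arc : ∀ {u v} → S u v → R (from u) (from v)

≅-sym : ∀ {A B : Set} {R : A → A → Set} {S : B → B → Set} → R ≅ S → S ≅ R
≅-sym e = record
  { to = from ; from = to ; from∘to = to∘from ; to∘from = from∘to
  ; to-arc = from-arc ; from-arc = to-arc }
  where open _≅_ e

involution-≅ : ∀ {A : Set} {R S : A → A → Set} (φ : A → A) → (∀ x → φ (φ x) ≡ x) →
               (∀ {u v} → R u v ⇔ S (φ u) (φ v)) → R ≅ S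
involution-≅ {R = R} {S} φ φ∘φ R⇔S = record
  { to = φ ; from = φ ; from∘to = φ∘φ ; to∘from = φ∘φ
  ; to-arc   = Equivalence.to R⇔S
  ; from-arc = λ {u v} e → Equivalence.from R⇔S (subst₂ S (sym (φ∘φ u)) (sym (φ∘φ v)) e) }

isDist-≅ : ∀ {A B : Set} {R : A → A → Set} {S : B → B → Set} (e : R ≅ S) →
           ∀ {u v k} → IsDist R u v k → IsDist S (_≅_.to e u) (_≅_.to e v) k
isDist-≅ {R = R} e {u} {v} (w , min) = walk-map to to-arc w , λ k′ k′<k w′ →
  min k′ k′<k (subst₂ (λ x y → Walk R x y k′) (from∘to u) (from∘to v) (walk-map from from-arc w′))
  where open _≅_ e

module _ {A B : Set} {R : A → A → Set} {S : B → B → Set} (e : R ≅ S) where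
  open _≅_ e

  isResolvingSet-≅ : ∀ {B} → IsResolvingSet R B → IsResolvingSet S (map to B)
  isResolvingSet-≅ {[]}    (B≢[] , _) = contradiction refl B≢[]
  isResolvingSet-≅ {b ∷ B} (_ , unique , resolves) =
    (λ ()) , Unique.map⁺ to-injective unique , λ x y same →
      trans (sym (to∘from x)) (trans (cong to (resolves (from x) (from y) (pullback same))) (to∘from y))
    where
    to-injective : ∀ {x y} → to x ≡ to y → x ≡ y
    to-injective {x} {y} eq = trans (sym (from∘to x)) (trans (cong from eq) (from∘to y))

    pullback : ∀ {x y} → SameRep S (map to (b ∷ B)) x y → SameRep R (b ∷ B) (from x) (from y)
    pullback same = All.map (λ { {c} (k , dx , dy) →
      k , subst (λ c′ → IsDist R _ c′ k) (from∘to c) (isDist-≅ (≅-sym e) dx)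
        , subst (λ c′ → IsDist R _ c′ k) (from∘to c) (isDist-≅ (≅-sym e) dy) }) (map⁻ same)

metricDim-≅ : ∀ {A B : Set} {R : A → A → Set} {S : B → B → Set} {d} →
              R ≅ S → MetricDim S d → MetricDim R d
metricDim-≅ {d = d} e ((B , resolving , |B|≡d) , minimal) =
  (map (_≅_.from e) B , isResolvingSet-≅ (≅-sym e) resolving , trans (length-map _ B) |B|≡d) ,
  λ B′ resolving′ → subst (d ≤_) (length-map _ B′) (minimal _ (isResolvingSet-≅ e resolving′))

-- The amalgam with all cycles oriented along their successor relation

module _ {t : ℕ} {n : Fin t → ℕ} where

  Forward : V t n → V t n → Set
  Forward u v = ∃ λ i → Step i u v

  _≟ᵛ_ : DecidableEquality (V t n)
  ta ≟ᵛ ta = yes refl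
  ta ≟ᵛ tb = no λ ()
  ta ≟ᵛ inr _ _ = no λ ()
  tb ≟ᵛ ta = no λ ()
  tb ≟ᵛ tb = yes refl
  tb ≟ᵛ inr _ _ = no λ ()
  inr _ _ ≟ᵛ ta = no λ ()
  inr _ _ ≟ᵛ tb = no λ ()
  inr i j ≟ᵛ inr k l with i Fin.≟ k
  ... | no i≢k = no λ { refl → i≢k refl }
  ... | yes refl with j Fin.≟ l
  ...   | yes refl = yes refl
  ...   | no j≢l = no λ { refl → j≢l refl }

  reverse : V t n → V t n
  reverse ta        = tb
  reverse tb        = ta
  reverse (inr i j) = inr i (opposite j)

  reverse-involutive : ∀ x → reverse (reverse x) ≡ x
  reverse-involutive ta        = refl
  reverse-involutive tb        = refl
  reverse-involutive (inr i j) = cong (inr i) (opposite-involutive j)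

  step-reverse : ∀ {i u v} → Step i u v → Step i (reverse v) (reverse u)
  step-reverse st-ab = st-ab
  step-reverse {i} (st-b j j≡0) =
    st-a (opposite j) (trans (suc-toℕ-opposite j) (cong (n i ∸ 2 ∸_) j≡0))
  step-reverse {i} (st-in j k 1+j≡k) =
    st-in (opposite k) (opposite j)
      (trans (suc-toℕ-opposite k) (trans (cong (n i ∸ 2 ∸_) (sym 1+j≡k)) (sym (opposite-prop j))))
  step-reverse {i} (st-a j 1+j≡m) =
    st-b (opposite j) (trans (opposite-prop j) (trans (cong (n i ∸ 2 ∸_) 1+j≡m) (n∸n≡0 (n i ∸ 2))))

  forward⇔reverse : ∀ {u v} → Forward v u ⇔ Forward (reverse u) (reverse v)
  forward⇔reverse {u} {v} = mk⇔
    (λ (i , st) → i , step-reverse st)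
    (λ (i , st) → i , subst₂ (Step i) (reverse-involutive v) (reverse-involutive u) (step-reverse st))

  adj-sym : ∀ {u v} → Adj {t} {n} u v → Adj v u
  adj-sym (i , st) = i , Sum.swap st

  terminal-edge-oriented-once : ∀ {Arc : V t n → V t n → Set} →
    IsOrientation Arc → Fin t → Arc ta tb → Arc tb ta → ⊥
  terminal-edge-oriented-once (_ , antisym) i₀ ab ba = proj₂ (antisym i₀ ta tb st-ab) (ab , ba)

  cycles-codirected : Fin t → ∀ {Arc : V t n → V t n → Set} →
    IsOrientation Arc → EachCycleDirected Arc →
    (∀ i {u v} → Step i u v → Arc u v) ⊎ (∀ i {u v} → Step i u v → Arc v u)
  cycles-codirected i₀ O directed with directed i₀
  ... | inj₁ fw₀ = inj₁ λ i {u v} st →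
    [ (λ fw → fw u v st)
    , (λ bw → ⊥-elim (terminal-edge-oriented-once O i₀ (fw₀ ta tb st-ab) (bw ta tb st-ab)))
    ]′ (directed i)
  ... | inj₂ bw₀ = inj₂ λ i {u v} st →
    [ (λ fw → ⊥-elim (terminal-edge-oriented-once O i₀ (fw ta tb st-ab) (bw₀ ta tb st-ab)))
    , (λ bw → bw u v st)
    ]′ (directed i)

  arc⇔forward : ∀ {Arc : V t n → V t n → Set} →
    (∀ u v → Arc u v → Adj u v) → (∀ i u v → Step i u v → ¬ (Arc u v × Arc v u)) →
    (∀ i {u v} → Step i u v → Arc u v) → ∀ {u v} → Arc u v ⇔ Forward u v
  arc⇔forward {Arc} sound antisym along {u} {v} = mk⇔ to (λ (i , st) → along i st)
    where
    to : Arc u v → Forward u v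
    to a with sound u v a
    ... | i , inj₁ st = i , st
    ... | i , inj₂ st = ⊥-elim (antisym i v u st (along i st , a))

  orientation-≅ : Fin t → ∀ {Arc : V t n → V t n → Set} →
    IsOrientation Arc → EachCycleDirected Arc → Arc ≅ Forward
  orientation-≅ i₀ {Arc} O@(sound , total) directed with cycles-codirected i₀ O directed
  ... | inj₁ along   = involution-≅ id (λ _ → refl) (arc⇔forward sound antisym along)
    where
    antisym : ∀ i u v → Step i u v → ¬ (Arc u v × Arc v u)
    antisym i u v st = proj₂ (total i u v st)
  ... | inj₂ against = involution-≅ reverse reverse-involutive (forward⇔reverse ⇔-∘ arc⇔backward)
    where
    antisym : ∀ i u v → Step i u v → ¬ (Arc v u × Arc u v)
    antisym i u v st = proj₂ (total i u v st) ∘ swap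
    arc⇔backward : ∀ {u v} → Arc u v ⇔ Forward v u
    arc⇔backward = arc⇔forward (λ u v a → adj-sym (sound v u a)) antisym against

-- Metric dimension of the forward orientation

module ForwardAmalgam (s : ℕ) (n : Fin (2 + s) → ℕ) (n≥3 : ∀ i → 3 ≤ n i) where

  Vertex : Set
  Vertex = V (2 + s) n

  Fwd : Vertex → Vertex → Set
  Fwd = Forward

  open Walks Fwd

  m : Fin (2 + s) → ℕ
  m i = n i ∸ 2

  1≤m : ∀ i → 1 ≤ m i
  1≤m i = ∸-monoˡ-≤ 2 (n≥3 i)

  suc[m∸1]≡m : ∀ i → suc (m i ∸ 1) ≡ m i
  suc[m∸1]≡m i = m+[n∸m]≡n (1≤m i)

  first last : ∀ i → Fin (m i)
  first i = fromℕ< (1≤m i)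
  last  i = fromℕ< (≤-reflexive (suc[m∸1]≡m i))

  toℕ-first : ∀ i → toℕ (first i) ≡ 0
  toℕ-first i = toℕ-fromℕ< (1≤m i)

  toℕ-last : ∀ i → toℕ (last i) ≡ m i ∸ 1
  toℕ-last i = toℕ-fromℕ< (≤-reflexive (suc[m∸1]≡m i))

  suc-toℕ-last : ∀ i → suc (toℕ (last i)) ≡ m i
  suc-toℕ-last i = trans (cong suc (toℕ-last i)) (suc[m∸1]≡m i)

  end : Fin (2 + s) → Vertex
  end i = inr i (last i)

  end-injective : ∀ {i k} → end i ≡ end k → i ≡ k
  end-injective refl = refl

  walk-within : ∀ i d (j l : Fin (m i)) → toℕ j + d ≡ toℕ l → Walk Fwd (inr i j) (inr i l) d
  walk-within i zero j l j+0≡l =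
    subst (λ l → Walk Fwd (inr i j) (inr i l) 0) (toℕ-injective (trans (sym (+-identityʳ _)) j+0≡l)) nil
  walk-within i (suc d) j l j+1+d≡l =
    cons (i , st-in j next (sym (toℕ-fromℕ< 1+j<m))) (walk-within i d next l next+d≡l)
    where
    1+j+d≡l : suc (toℕ j + d) ≡ toℕ l
    1+j+d≡l = trans (sym (+-suc (toℕ j) d)) j+1+d≡l
    1+j<m : suc (toℕ j) < m i
    1+j<m = ≤-<-trans (≤-trans (s≤s (m≤m+n (toℕ j) d)) (≤-reflexive 1+j+d≡l)) (toℕ<n l)
    next : Fin (m i)
    next = fromℕ< 1+j<m
    next+d≡l : toℕ next + d ≡ toℕ l
    next+d≡l = trans (cong (_+ d) (toℕ-fromℕ< 1+j<m)) 1+j+d≡l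

  walk-inner→end : ∀ k (j : Fin (m k)) → Walk Fwd (inr k j) (end k) (m k ∸ suc (toℕ j))
  walk-inner→end k j = walk-within k _ j (last k) (trans (m+[n∸[1+m]]≡n∸1 (toℕ<n j)) (sym (toℕ-last k)))

  walk-inner→ta : ∀ k (j : Fin (m k)) → Walk Fwd (inr k j) ta (m k ∸ toℕ j)
  walk-inner→ta k j = subst (Walk Fwd (inr k j) ta)
    (trans (+-comm _ 1) (sym (+-∸-assoc 1 (toℕ<n j))))
    (walk-inner→end k j ++ʷ cons (k , st-a (last k) (suc-toℕ-last k)) nil)

  walk-tb→end : ∀ i → Walk Fwd tb (end i) (m i)
  walk-tb→end i = subst (Walk Fwd tb (end i)) (suc[m∸1]≡m i)
    (cons (i , st-b (first i) (toℕ-first i))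
      (walk-within i (m i ∸ 1) (first i) (last i)
        (trans (cong (_+ (m i ∸ 1)) (toℕ-first i)) (sym (toℕ-last i)))))

  distToEnd : Fin (2 + s) → Vertex → ℕ
  distToEnd i ta = suc (m i)
  distToEnd i tb = m i
  distToEnd i (inr k j) with k Fin.≟ i
  ... | yes _ = m k ∸ suc (toℕ j)
  ... | no  _ = m k ∸ toℕ j + suc (m i)

  distToEnd-isPotential : ∀ i → IsPotential (end i) (distToEnd i)
  distToEnd-isPotential i = at-end , step
    where
    at-end : distToEnd i (end i) ≡ 0
    at-end with i Fin.≟ i
    ... | yes _  = trans (cong (m i ∸_) (suc-toℕ-last i)) (n∸n≡0 (m i))
    ... | no i≢i = contradiction refl i≢i
    step : ∀ u v → Fwd u v → distToEnd i u ≤ suc (distToEnd i v)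
    step _ _ (k , st-ab) = ≤-refl
    step _ _ (k , st-b j j≡0) with k Fin.≟ i
    ... | yes refl rewrite j≡0 = m≤n+m∸n (m k) 1
    ... | no  _    = ≤-trans (n≤1+n (m i)) (≤-trans (m≤n+m (suc (m i)) _) (n≤1+n _))
    step _ _ (k , st-in j j′ 1+j≡j′) with k Fin.≟ i
    ... | yes refl rewrite sym 1+j≡j′ = m∸n≤1+m∸[1+n] (m k) (suc (toℕ j))
    ... | no  _    rewrite sym 1+j≡j′ = +-monoˡ-≤ (suc (m i)) (m∸n≤1+m∸[1+n] (m k) (toℕ j))
    step _ _ (k , st-a j 1+j≡m) with k Fin.≟ i
    ... | yes refl = ≤-trans (m∸n≤m (m k) (suc (toℕ j))) (≤-trans (n≤1+n _) (n≤1+n _))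
    ... | no  _    = ≤-reflexive (cong (_+ suc (m i)) m∸j≡1)
      where
      m∸j≡1 : m k ∸ toℕ j ≡ 1
      m∸j≡1 = trans (cong (_∸ toℕ j) (sym 1+j≡m)) (m+n∸n≡m 1 (toℕ j))

  walk→end : ∀ i u → Walk Fwd u (end i) (distToEnd i u)
  walk→end i ta = cons (i , st-ab) (walk-tb→end i)
  walk→end i tb = walk-tb→end i
  walk→end i (inr k j) with k Fin.≟ i
  ... | yes refl = walk-inner→end k j
  ... | no  _    = walk-inner→ta k j ++ʷ cons (i , st-ab) (walk-tb→end i)

  isDist-end : ∀ i u → IsDist Fwd u (end i) (distToEnd i u)
  isDist-end i u = isDist-potential (distToEnd-isPotential i) (walk→end i u)

  -- A lower bound on d(·, inr i j) that is exact at ta, the only place it is needed.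
  potentialToInner : ∀ i → Fin (m i) → Vertex → ℕ
  potentialToInner i j ta = suc (suc (toℕ j))
  potentialToInner i j tb = suc (toℕ j)
  potentialToInner i j (inr k j′) with k Fin.≟ i
  ... | yes _ = toℕ j ∸ toℕ j′
  ... | no  _ = suc (suc (toℕ j))

  potentialToInner-isPotential : ∀ i j → IsPotential (inr i j) (potentialToInner i j)
  potentialToInner-isPotential i j = at-inner , step
    where
    at-inner : potentialToInner i j (inr i j) ≡ 0
    at-inner with i Fin.≟ i
    ... | yes _  = n∸n≡0 (toℕ j)
    ... | no i≢i = contradiction refl i≢i
    step : ∀ u v → Fwd u v → potentialToInner i j u ≤ suc (potentialToInner i j v)
    step _ _ (k , st-ab) = ≤-refl
    step _ _ (k , st-b j′ j′≡0) with k Fin.≟ i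
    ... | yes refl rewrite j′≡0 = ≤-refl
    ... | no  _    = s≤s (≤-trans (n≤1+n _) (n≤1+n _))
    step _ _ (k , st-in j′ j″ 1+j′≡j″) with k Fin.≟ i
    ... | yes refl rewrite sym 1+j′≡j″ = m∸n≤1+m∸[1+n] (toℕ j) (toℕ j′)
    ... | no  _    = n≤1+n _
    step _ _ (k , st-a j′ _) with k Fin.≟ i
    ... | yes refl = ≤-trans (m∸n≤m (toℕ j) (toℕ j′)) (≤-trans (n≤1+n _) (≤-trans (n≤1+n _) (n≤1+n _)))
    ... | no  _    = n≤1+n _

  isDist-from-ta : ∀ b → ∃ λ d → IsDist Fwd ta b d
  isDist-from-ta ta = 0 , nil , λ _ ()
  isDist-from-ta tb = 1 , cons (Fin.zero , st-ab) nil , λ { zero _ () ; (suc _) (s≤s ()) _ }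
  isDist-from-ta (inr i j) = potentialToInner i j ta ,
    isDist-potential (potentialToInner-isPotential i j)
      (cons (i , st-ab) (cons (i , st-b (first i) (toℕ-first i))
        (walk-within i (toℕ j) (first i) j (cong (_+ toℕ j) (toℕ-first i)))))

  walk-from-end : ∀ {i b k} → Walk Fwd (end i) b (suc k) → Walk Fwd ta b k
  walk-from-end {i} (cons (_ , st-in _ j 1+last≡j) _) =
    contradiction (trans (sym 1+last≡j) (suc-toℕ-last i)) (<⇒≢ (toℕ<n j))
  walk-from-end (cons (_ , st-a _ _) p) = p

  isDist-from-end : ∀ {i b d} → b ≢ end i → IsDist Fwd ta b d → IsDist Fwd (end i) b (suc d)
  isDist-from-end {i} {b} {d} b≢end (w , min) = cons (i , st-a (last i) (suc-toℕ-last i)) w , shorter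
    where
    shorter : ∀ k → k < suc d → ¬ Walk Fwd (end i) b k
    shorter zero    _         nil = b≢end refl
    shorter (suc k) (s≤s k<d) w′  = min k k<d (walk-from-end w′)

  ends-sameRep : ∀ B i k → end i ∉ B → end k ∉ B → SameRep Fwd B (end i) (end k)
  ends-sameRep B i k i∉B k∉B = All.tabulate λ {b} b∈B →
    let d , dist = isDist-from-ta b in
    suc d , isDist-from-end {i} (λ { refl → i∉B b∈B }) dist
          , isDist-from-end {k} (λ { refl → k∉B b∈B }) dist

  open import Data.List.Membership.DecPropositional (_≟ᵛ_ {2 + s} {n}) using (_∈?_)

  resolvingSet-length≥ : ∀ B → IsResolvingSet Fwd B → suc s ≤ length B
  resolvingSet-length≥ B (_ , _ , resolves) = s≤s⁻¹ (injective⇒≤ {f = position} position-injective)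
    where
    position : Fin (2 + s) → Fin (suc (length B))
    position i with end i ∈? B
    ... | yes end∈B = Fin.suc (Any.index end∈B)
    ... | no  _     = Fin.zero
    position-injective : ∀ {i k} → position i ≡ position k → i ≡ k
    position-injective {i} {k} eq with end i ∈? B | end k ∈? B
    ... | yes i∈B | yes k∈B = end-injective (trans (lookup-index i∈B)
            (trans (cong (List.lookup B) (Fin.suc-injective eq)) (sym (lookup-index k∈B))))
    ... | no  i∉B | no  k∉B = end-injective (resolves (end i) (end k) (ends-sameRep B i k i∉B k∉B))
    ... | yes _   | no  _   with () ← eq
    ... | no  _   | yes _   with () ← eq

  distToEnd-own : ∀ i j → distToEnd i (inr i j) < m i
  distToEnd-own i j with i Fin.≟ i
  ... | yes _  = ∸-monoʳ-< z<s (toℕ<n j)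
  ... | no i≢i = contradiction refl i≢i

  distToEnd-other : ∀ i k j → k ≢ i → suc (m i) < distToEnd i (inr k j)
  distToEnd-other i k j k≢i with k Fin.≟ i
  ... | yes k≡i = contradiction k≡i k≢i
  ... | no  _   = +-monoˡ-≤ (suc (m i)) (m<n⇒0<n∸m (toℕ<n j))

  distToEnd-inner∉[m,1+m] : ∀ i k j → distToEnd i (inr k j) < m i ⊎ suc (m i) < distToEnd i (inr k j)
  distToEnd-inner∉[m,1+m] i k j = by-cycle (k Fin.≟ i)
    where
    by-cycle : Dec (k ≡ i) → distToEnd i (inr k j) < m i ⊎ suc (m i) < distToEnd i (inr k j)
    by-cycle (yes refl) = inj₁ (distToEnd-own k j)
    by-cycle (no k≢i)   = inj₂ (distToEnd-other i k j k≢i)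

  distToEnd-inner-injective : ∀ i k (j j′ : Fin (m k)) →
    distToEnd i (inr k j) ≡ distToEnd i (inr k j′) → j ≡ j′
  distToEnd-inner-injective i k j j′ eq with k Fin.≟ i
  ... | yes _ = toℕ-injective (suc-injective (∸-cancelˡ-≡ (toℕ<n j) (toℕ<n j′) eq))
  ... | no  _ = toℕ-injective
    (∸-cancelˡ-≡ (<⇒≤ (toℕ<n j)) (<⇒≤ (toℕ<n j′)) (+-cancelʳ-≡ (suc (m i)) _ _ eq))

  ends-separate-cycles : ∀ k k′ j j′ → k ≢ k′ → distToEnd k (inr k j) ≢ distToEnd k (inr k′ j′)
  ends-separate-cycles k k′ j j′ k≢k′ eq = <-irrefl eq
    (<-trans (distToEnd-own k j) (<-trans (n<1+n (m k)) (distToEnd-other k k′ j′ (k≢k′ ∘ sym))))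

  resolved-by-ends : ∀ x y → (∀ a → distToEnd (inject₁ a) x ≡ distToEnd (inject₁ a) y) → x ≡ y
  resolved-by-ends ta ta _ = refl
  resolved-by-ends tb tb _ = refl
  resolved-by-ends ta tb same = contradiction (same Fin.zero) 1+n≢n
  resolved-by-ends tb ta same = contradiction (sym (same Fin.zero)) 1+n≢n
  resolved-by-ends ta (inr k j) same =
    contradiction (same Fin.zero) (proj₂ (outside⇒≢ (distToEnd-inner∉[m,1+m] Fin.zero k j)))
  resolved-by-ends tb (inr k j) same =
    contradiction (same Fin.zero) (proj₁ (outside⇒≢ (distToEnd-inner∉[m,1+m] Fin.zero k j)))
  resolved-by-ends (inr k j) ta same =
    contradiction (sym (same Fin.zero)) (proj₂ (outside⇒≢ (distToEnd-inner∉[m,1+m] Fin.zero k j)))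
  resolved-by-ends (inr k j) tb same =
    contradiction (sym (same Fin.zero)) (proj₁ (outside⇒≢ (distToEnd-inner∉[m,1+m] Fin.zero k j)))
  resolved-by-ends (inr k j) (inr k′ j′) same with k Fin.≟ k′
  ... | yes refl = cong (inr k) (distToEnd-inner-injective Fin.zero k j j′ (same Fin.zero))
  ... | no k≢k′ with inject₁⊎fromℕ k | inject₁⊎fromℕ k′
  ...   | inj₁ (a , refl) | _               =
    contradiction (same a) (ends-separate-cycles _ k′ j j′ k≢k′)
  ...   | inj₂ _          | inj₁ (a , refl) =
    contradiction (sym (same a)) (ends-separate-cycles _ k j′ j (k≢k′ ∘ sym))
  ...   | inj₂ refl       | inj₂ refl       = contradiction refl k≢k′

  ends-but-last : List Vertex
  ends-but-last = map (end ∘ inject₁) (allFin (suc s))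

  isResolvingSet-ends-but-last : IsResolvingSet Fwd ends-but-last
  isResolvingSet-ends-but-last =
    (λ ()) , Unique.map⁺ (inject₁-injective ∘ end-injective) (Unique.allFin⁺ (suc s)) ,
    λ x y same → resolved-by-ends x y λ a →
      let _ , dx , dy = All.lookup same (∈-map⁺ (end ∘ inject₁) (∈-allFin a)) in
      trans (isDist-unique (isDist-end _ x) dx) (sym (isDist-unique (isDist-end _ y) dy))

  metricDim : MetricDim Fwd (suc s)
  metricDim =
    (ends-but-last , isResolvingSet-ends-but-last ,
     trans (length-map _ (allFin (suc s))) (length-tabulate (λ a → a))) ,
    resolvingSet-length≥

mainTheorem8 : (t : ℕ) → 2 ≤ t → (n : Fin t → ℕ) → (∀ i → 3 ≤ n i) →
    (Arc : V t n → V t n → Set) → IsOrientation Arc → EachCycleDirected Arc →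
    MetricDim Arc (t ∸ 1)
mainTheorem8 (suc (suc s)) _ n n≥3 Arc O directed =
  metricDim-≅ (orientation-≅ Fin.zero O directed) (ForwardAmalgam.metricDim s n n≥3)
mainTheorem8 1 (s≤s ())
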